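{- Let $F$ be a local field with residue characteristic $p$ and valuation $v_F$, and let $\phi:F\to F$, $\phi(x)=x^p$, also applied entrywise to matrices. Let $A=(a_{ij})\in M_k(F)$ and let $\tau$ be a permutation of $\{1,\dots,k\}$ chosen so that $\gamma=\prod_{i=1}^k a_{i,\tau(i)}$ has minimum valuation among the $k!$ terms in the Leibniz expansion of $\det(A)$. Then (a) $\det(\phi(A))\equiv\phi(\det(A))\pmod{p\gamma^p}$; (b) if $d,\mu\in F$ satisfy $\det(A)\equiv d\pmod{\mu}$, then $\det(\phi(A))\equiv\phi(d)\pmod{(p\gamma^p,\mu^p)}$.
   Context: A local field is a field $F$ complete with respect to a discrete valuation $v_F$ with $v_F(F^\times)=\mathbb{Z}$ and perfect residue field of characteristic $p$. For $x,y,z,w\in F$, $x\equiv y\pmod{z}$ means $v_F(x-y)\ge v_F(z)$, and $x\equiv y\pmod{(z,w)}$ means $v_F(x-y)\ge\min\{v_F(z),v_F(w)\}$. -}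

module Defs where

open import Level using (Level; _⊔_) renaming (suc to lsuc)
open import Data.Nat as ℕ using (ℕ; zero; suc)
open import Data.Nat.Primality using (Prime)
open import Data.Integer as ℤ using (ℤ)
open import Data.Fin using (Fin; zero; suc; _<?_)
open import Data.Fin.Permutation using (Permutation′; _⟨$⟩ʳ_; insert)
open import Data.List using (List; []; _∷_; map; concatMap; foldr)
open import Data.List using () renaming (allFin to allFinL)
open import Data.Bool using (Bool; true; false; if_then_else_)
open import Data.Product using (∃; _×_; _,_)
open import Relation.Nullary using (¬_; does)
open import Relation.Binary.PropositionalEquality using (_≡_)
open import Algebra.Bundles using (CommutativeRing)

-- Extended integers ℤ ∪ {∞} (value group of a discrete valuation, with v(0)=∞)

data ℤ∞ : Set where
  fin : ℤ → ℤ∞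
  ∞   : ℤ∞

data _≤∞_ : ℤ∞ → ℤ∞ → Set where
  fin≤fin : ∀ {m n} → m ℤ.≤ n → fin m ≤∞ fin n
  _≤∞∞    : ∀ x → x ≤∞ ∞

_<∞_ : ℤ∞ → ℤ∞ → Set
x <∞ y = ¬ (y ≤∞ x)

_+∞_ : ℤ∞ → ℤ∞ → ℤ∞
fin m +∞ fin n = fin (m ℤ.+ n)
fin _ +∞ ∞     = ∞
∞     +∞ _     = ∞

min∞ : ℤ∞ → ℤ∞ → ℤ∞
min∞ (fin m) (fin n) = fin (m ℤ.⊓ n)
min∞ (fin m) ∞       = fin m
min∞ ∞       y       = y

module RingOps {c ℓ : Level} (R : CommutativeRing c ℓ) where
  open CommutativeRing R

  _^_ : Carrier → ℕ → Carrier
  x ^ zero  = 1#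
  x ^ suc n = x * (x ^ n)

  ℕ⇒F : ℕ → Carrier
  ℕ⇒F zero    = 0#
  ℕ⇒F (suc n) = 1# + ℕ⇒F n

record LocalField (c ℓ : Level) : Set (lsuc (c ⊔ ℓ)) where
  field
    cring : CommutativeRing c ℓ
  open CommutativeRing cring public using (Carrier; _≈_; _+_; _*_; -_; _-_; 0#; 1#)

  open RingOps cring public

  field
    0≉1     : ¬ (0# ≈ 1#)
    inverse : ∀ x → ¬ (x ≈ 0#) → ∃ λ y → x * y ≈ 1#
    v        : Carrier → ℤ∞
    v-cong   : ∀ {x y} → x ≈ y → v x ≡ v y
    v-∞⇒0    : ∀ x → v x ≡ ∞ → x ≈ 0#
    v-0      : v 0# ≡ ∞
    v-mul    : ∀ x y → v (x * y) ≡ v x +∞ v y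
    v-add    : ∀ x y → min∞ (v x) (v y) ≤∞ v (x + y)
    v-surj   : ∀ n → ∃ λ x → v x ≡ fin n
    complete : (s : ℕ → Carrier) →
               (∀ (n : ℤ) → ∃ λ N → ∀ i j → N ℕ.≤ i → N ℕ.≤ j → fin n ≤∞ v (s i - s j)) →
               ∃ λ L → ∀ (n : ℤ) → ∃ λ N → ∀ i → N ℕ.≤ i → fin n ≤∞ v (s i - L)
    -- residue field O/m has characteristic p (p prime): p·1 ∈ m
    p         : ℕ
    p-prime   : Prime p
    residue-char : fin (ℤ.+ 0) <∞ v (ℕ⇒F p)
    -- residue field is perfect: Frobenius on O/m is surjective
    residue-perfect : ∀ x → fin (ℤ.+ 0) ≤∞ v x →
                      ∃ λ y → fin (ℤ.+ 0) ≤∞ v y × fin (ℤ.+ 0) <∞ v (x - y ^ p)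

module LF {c ℓ : Level} (F : LocalField c ℓ) where
  open LocalField F public

  Matrix : ℕ → Set c
  Matrix k = Fin k → Fin k → Carrier

  φ : Carrier → Carrier
  φ x = x ^ p

  φM : ∀ {k} → Matrix k → Matrix k
  φM A i j = φ (A i j)

  ∑ℕ : ∀ {k} → (Fin k → ℕ) → ℕ
  ∑ℕ {zero}  f = zero
  ∑ℕ {suc k} f = f zero ℕ.+ ∑ℕ (λ i → f (suc i))

  ∏ : ∀ {k} → (Fin k → Carrier) → Carrier
  ∏ {zero}  f = 1#
  ∏ {suc k} f = f zero * ∏ (λ i → f (suc i))

  ∑L : List Carrier → Carrier
  ∑L = foldr _+_ 0#

  -- list of all permutations of {0,…,k-1} (each exactly once):
  -- a permutation of suc k is uniquely  insert 0 j σ  with σ a permutation of k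
  perms : ∀ k → List (Permutation′ k)
  perms zero    = Data.Fin.Permutation.id ∷ []
  perms (suc k) = concatMap (λ j → map (insert zero j) (perms k)) (allFinL (suc k))

  inversions : ∀ {k} → Permutation′ k → ℕ
  inversions σ = ∑ℕ λ i → ∑ℕ λ j →
    if does (i <? j) then (if does ((σ ⟨$⟩ʳ j) <? (σ ⟨$⟩ʳ i)) then 1 else 0) else 0

  even : ℕ → Bool
  even zero          = true
  even (suc zero)    = false
  even (suc (suc n)) = even n

  term : ∀ {k} → Matrix k → Permutation′ k → Carrier
  term A σ = ∏ λ i → A i (σ ⟨$⟩ʳ i)

  signedTerm : ∀ {k} → Matrix k → Permutation′ k → Carrier
  signedTerm A σ = if even (inversions σ) then term A σ else - term A σ

  det : ∀ {k} → Matrix k → Carrier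
  det {k} A = ∑L (map (signedTerm A) (perms k))

  _≡_mod_ : Carrier → Carrier → Carrier → Set
  x ≡ y mod z = v z ≤∞ v (x - y)

  _≡_mod⟨_,_⟩ : Carrier → Carrier → Carrier → Carrier → Set
  x ≡ y mod⟨ z , w ⟩ = min∞ (v z) (v w) ≤∞ v (x - y)

{-# OPTIONS --safe #-}
-- Every Leibniz term of det A, hence also every partial sum of the Leibniz
-- expansion, has valuation at least v γ.  For a prime n and v a, v b ≥ v c the
-- freshman's dream (a + b)ⁿ ≡ aⁿ + bⁿ holds modulo n·cⁿ, since n divides every
-- middle binomial coefficient; together with (-t)ⁿ ≡ -tⁿ this turns
-- det φ(A) = Σ ± t_σᵖ into (Σ ± t_σ)ᵖ one term at a time.  For (b) write
-- det A = d + e with v e ≥ v μ: the one of γ, μ of smaller valuation bounds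
-- both det A and d, so det(A)ᵖ ≡ dᵖ + eᵖ, and eᵖ ≡ 0 modulo μᵖ.
module Submission where

open import Defs
open import Level using (Level)
open import Data.Nat using (ℕ)
open import Data.Product using (_×_)
open import Data.Fin.Permutation using (Permutation′)

open import Level using (0ℓ)
open import Data.Nat as ℕ using (zero; suc; _∸_; s≤s; z≤n)
import Data.Nat.Properties as ℕ
open import Data.Nat.Combinatorics using (_C_; nC1≡n; nCn≡1; nCk+nC[k+1]≡[n+1]C[k+1])
open import Data.Nat.Divisibility using (_∣_; divides; ∣⇒≤; quotient; m∣n⇒n≡m*quotient)
open import Data.Nat.Primality using (Prime; euclidsLemma)
open import Data.Integer as ℤ using (0ℤ; +0; +[1+_]; -[1+_])
import Data.Integer.Properties as ℤ
open import Data.Fin using (Fin; toℕ; fromℕ; inject₁) renaming (zero to fz; suc to fs)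
open import Data.Fin.Properties using (toℕ-fromℕ; toℕ-inject₁; toℕ<n)
open import Data.Fin.Permutation using (_⟨$⟩ʳ_)
open import Data.List using (List; []; _∷_; map)
open import Data.Bool using (true; false)
open import Data.Product using (_,_)
open import Data.Sum using (_⊎_; inj₁; inj₂)
open import Data.Empty using (⊥-elim)
open import Relation.Nullary using (contradiction)
open import Relation.Binary.Bundles using (Setoid)
open import Relation.Binary.PropositionalEquality
  using (_≡_; refl; sym; trans; cong; cong₂; subst; subst₂; module ≡-Reasoning)
open import Algebra.Bundles using (CommutativeRing)

[k+1]*[n+1]C[k+1]≡[n+1]*nCk : ∀ n k → suc k ℕ.* (suc n C suc k) ≡ suc n ℕ.* (n C k)
[k+1]*[n+1]C[k+1]≡[n+1]*nCk zero    zero    = refl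
[k+1]*[n+1]C[k+1]≡[n+1]*nCk zero    (suc k) = ℕ.*-zeroʳ (suc (suc k))
[k+1]*[n+1]C[k+1]≡[n+1]*nCk (suc n) zero    = trans (ℕ.+-identityʳ _) (trans (nC1≡n (suc (suc n))) (sym (ℕ.*-identityʳ _)))
[k+1]*[n+1]C[k+1]≡[n+1]*nCk (suc n) (suc k) = begin
  suc (suc k) ℕ.* (suc (suc n) C suc (suc k))
    ≡⟨ cong (suc (suc k) ℕ.*_) (nCk+nC[k+1]≡[n+1]C[k+1] (suc n) (suc k)) ⟨
  suc (suc k) ℕ.* (X ℕ.+ Y)
    ≡⟨ ℕ.*-distribˡ-+ (suc (suc k)) X Y ⟩
  (X ℕ.+ suc k ℕ.* X) ℕ.+ suc (suc k) ℕ.* Y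
    ≡⟨ ℕ.+-assoc X (suc k ℕ.* X) _ ⟩
  X ℕ.+ (suc k ℕ.* X ℕ.+ suc (suc k) ℕ.* Y)
    ≡⟨ cong (X ℕ.+_) (cong₂ ℕ._+_ ([k+1]*[n+1]C[k+1]≡[n+1]*nCk n k) ([k+1]*[n+1]C[k+1]≡[n+1]*nCk n (suc k))) ⟩
  X ℕ.+ (suc n ℕ.* (n C k) ℕ.+ suc n ℕ.* (n C suc k))
    ≡⟨ cong (X ℕ.+_) (sym (ℕ.*-distribˡ-+ (suc n) (n C k) (n C suc k))) ⟩
  X ℕ.+ suc n ℕ.* (n C k ℕ.+ n C suc k)
    ≡⟨ cong (λ z → X ℕ.+ suc n ℕ.* z) (nCk+nC[k+1]≡[n+1]C[k+1] n k) ⟩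
  suc (suc n) ℕ.* X
    ∎
  where
  open ≡-Reasoning
  X = suc n C suc k
  Y = suc n C suc (suc k)

p∣pCk : ∀ {p k} → Prime p → 0 ℕ.< k → k ℕ.< p → p ∣ p C k
p∣pCk {suc q} {suc j} p-prime _ k<p
  with euclidsLemma (suc j) (suc q C suc j) p-prime
         (divides (q C j) (trans ([k+1]*[n+1]C[k+1]≡[n+1]*nCk q j) (ℕ.*-comm (suc q) (q C j))))
... | inj₁ p∣k   = contradiction (∣⇒≤ p∣k) (ℕ.<⇒≱ k<p)
... | inj₂ p∣pCk = p∣pCk

≤∞-refl : ∀ {x} → x ≤∞ x
≤∞-refl {fin m} = fin≤fin ℤ.≤-refl
≤∞-refl {∞}     = ∞ ≤∞∞

≤∞-reflexive : ∀ {x y} → x ≡ y → x ≤∞ y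
≤∞-reflexive refl = ≤∞-refl

≤∞-trans : ∀ {x y z} → x ≤∞ y → y ≤∞ z → x ≤∞ z
≤∞-trans (fin≤fin m≤n) (fin≤fin n≤o) = fin≤fin (ℤ.≤-trans m≤n n≤o)
≤∞-trans {x} _         (_ ≤∞∞)       = x ≤∞∞

≤∞-total : ∀ x y → x ≤∞ y ⊎ y ≤∞ x
≤∞-total (fin m) (fin n) with ℤ.≤-total m n
... | inj₁ m≤n = inj₁ (fin≤fin m≤n)
... | inj₂ n≤m = inj₂ (fin≤fin n≤m)
≤∞-total x       ∞       = inj₁ (x ≤∞∞)
≤∞-total ∞       y       = inj₂ (y ≤∞∞)

+∞-mono-≤ : ∀ {x x′ y y′} → x ≤∞ x′ → y ≤∞ y′ → (x +∞ y) ≤∞ (x′ +∞ y′)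
+∞-mono-≤ (fin≤fin x≤x′) (fin≤fin y≤y′) = fin≤fin (ℤ.+-mono-≤ x≤x′ y≤y′)
+∞-mono-≤ {x} {fin _} {y} (fin≤fin _) (_ ≤∞∞) = (x +∞ y) ≤∞∞
+∞-mono-≤ {x} {∞}     {y} (_ ≤∞∞)     _       = (x +∞ y) ≤∞∞

+∞-identityˡ : ∀ x → fin 0ℤ +∞ x ≡ x
+∞-identityˡ (fin m) = cong fin (ℤ.+-identityˡ m)
+∞-identityˡ ∞       = refl

x≤y+∞x : ∀ {y} x → fin 0ℤ ≤∞ y → x ≤∞ (y +∞ x)
x≤y+∞x {fin n} (fin m) (fin≤fin 0≤n) = fin≤fin (ℤ.i≤j+i m n {{ℤ.nonNegative 0≤n}})
x≤y+∞x {fin n} ∞       _             = ∞ ≤∞∞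
x≤y+∞x {∞}     x       _             = x ≤∞∞

min∞-≤ˡ : ∀ x y → min∞ x y ≤∞ x
min∞-≤ˡ (fin m) (fin n) = fin≤fin (ℤ.i⊓j≤i m n)
min∞-≤ˡ (fin m) ∞       = ≤∞-refl
min∞-≤ˡ ∞       y       = y ≤∞∞

min∞-≤ʳ : ∀ x y → min∞ x y ≤∞ y
min∞-≤ʳ (fin m) (fin n) = fin≤fin (ℤ.i⊓j≤j m n)
min∞-≤ʳ (fin m) ∞       = fin m ≤∞∞
min∞-≤ʳ ∞       y       = ≤∞-refl

min∞-glb : ∀ {x y z} → z ≤∞ x → z ≤∞ y → z ≤∞ min∞ x y
min∞-glb (fin≤fin z≤x) (fin≤fin z≤y) = fin≤fin (ℤ.⊓-glb z≤x z≤y)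
min∞-glb (fin≤fin z≤x) (_ ≤∞∞)       = fin≤fin z≤x
min∞-glb (_ ≤∞∞)       z≤y           = z≤y

x+∞x≡x⇒x≡∞⊎x≡0 : ∀ {x} → x +∞ x ≡ x → x ≡ ∞ ⊎ x ≡ fin 0ℤ
x+∞x≡x⇒x≡∞⊎x≡0 {∞}     _     = inj₁ refl
x+∞x≡x⇒x≡∞⊎x≡0 {fin m} m+m≡m = inj₂ (cong fin (identityʳ-unique m m (fin-injective m+m≡m)))
  where
  open import Algebra.Properties.AbelianGroup ℤ.+-0-abelianGroup using (identityʳ-unique)
  fin-injective : ∀ {m n} → fin m ≡ fin n → m ≡ n
  fin-injective refl = refl

x+∞x≡0⇒x≡0 : ∀ {x} → x +∞ x ≡ fin 0ℤ → x ≡ fin 0ℤ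
x+∞x≡0⇒x≡0 {fin +0}       _  = refl
x+∞x≡0⇒x≡0 {fin +[1+ n ]} ()
x+∞x≡0⇒x≡0 {fin -[1+ n ]} ()
x+∞x≡0⇒x≡0 {∞}            ()

module _ {c ℓ} (F : LocalField c ℓ) where
  open LF F
  open CommutativeRing cring
    using ( setoid; ring; +-abelianGroup; semiring; commutativeSemiring; +-monoid
          ; +-cong; +-congˡ; *-congˡ; +-assoc; +-comm
          ; +-identityˡ; +-identityʳ; *-identityˡ; *-identityʳ; -‿cong; -‿inverseʳ; -‿inverseˡ; zeroˡ; distribʳ)
    renaming (refl to ≈-refl; sym to ≈-sym; trans to ≈-trans; reflexive to ≈-reflexive)
  open import Algebra.Properties.Ring ring using (-1*x≈-x)
  open import Algebra.Properties.AbelianGroup +-abelianGroup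
    using (⁻¹-involutive; ⁻¹-∙-comm; ⁻¹-anti-homo‿-; xyx⁻¹≈y; x≈y⇒x∙y⁻¹≈ε; ε⁻¹≈ε)
  open import Algebra.Properties.CommutativeSemigroup (CommutativeRing.+-commutativeSemigroup cring)
    using (interchange)
  import Algebra.Properties.Semiring.Exp semiring as Exp
  import Algebra.Properties.CommutativeSemiring.Exp commutativeSemiring as CExp
  open import Algebra.Properties.Semiring.Mult semiring using (×-assocˡ) renaming (_×_ to _·_)
  open import Algebra.Properties.Monoid.Sum +-monoid using (sum; sum-init-last)
  open import Algebra.Properties.CommutativeSemiring.Binomial commutativeSemiring
    using (binomialTerm; theorem)

  v-1# : v 1# ≡ fin 0ℤ
  v-1# with x+∞x≡x⇒x≡∞⊎x≡0 (trans (sym (v-mul 1# 1#)) (v-cong (*-identityˡ 1#)))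
  ... | inj₁ v1≡∞ = ⊥-elim (0≉1 (≈-sym (v-∞⇒0 1# v1≡∞)))
  ... | inj₂ v1≡0 = v1≡0

  v-[-1#] : v (- 1#) ≡ fin 0ℤ
  v-[-1#] = x+∞x≡0⇒x≡0 (begin
    v (- 1#) +∞ v (- 1#)  ≡⟨ v-mul (- 1#) (- 1#) ⟨
    v (- 1# * - 1#)       ≡⟨ v-cong (≈-trans (-1*x≈-x (- 1#)) (⁻¹-involutive 1#)) ⟩
    v 1#                  ≡⟨ v-1# ⟩
    fin 0ℤ                ∎)
    where open ≡-Reasoning

  v-neg : ∀ x → v (- x) ≡ v x
  v-neg x = begin
    v (- x)          ≡⟨ v-cong (-1*x≈-x x) ⟨
    v (- 1# * x)     ≡⟨ v-mul (- 1#) x ⟩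
    v (- 1#) +∞ v x  ≡⟨ cong (_+∞ v x) v-[-1#] ⟩
    fin 0ℤ +∞ v x    ≡⟨ +∞-identityˡ (v x) ⟩
    v x              ∎
    where open ≡-Reasoning

  infix 4 _≤v_
  _≤v_ : ℤ∞ → Carrier → Set
  h ≤v x = h ≤∞ v x

  ≤v-cong : ∀ {h x y} → x ≈ y → h ≤v x → h ≤v y
  ≤v-cong {h} x≈y = subst (h ≤∞_) (v-cong x≈y)

  ≤v-0# : ∀ {h} → h ≤v 0#
  ≤v-0# {h} = subst (h ≤∞_) (sym v-0) (h ≤∞∞)

  ≤v-+ : ∀ {h x y} → h ≤v x → h ≤v y → h ≤v x + y
  ≤v-+ {x = x} {y} h≤x h≤y = ≤∞-trans (min∞-glb h≤x h≤y) (v-add x y)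

  ≤v-neg : ∀ {h x} → h ≤v x → h ≤v - x
  ≤v-neg {h} {x} = subst (h ≤∞_) (sym (v-neg x))

  ≤v-· : ∀ {h x} m → h ≤v x → h ≤v m · x
  ≤v-· zero    h≤x = ≤v-0#
  ≤v-· (suc m) h≤x = ≤v-+ h≤x (≤v-· m h≤x)

  ≤v-sum : ∀ {h m} (t : Fin m → Carrier) → (∀ i → h ≤v t i) → h ≤v sum t
  ≤v-sum {m = zero}  t h≤t = ≤v-0#
  ≤v-sum {m = suc m} t h≤t = ≤v-+ (h≤t fz) (≤v-sum (λ i → t (fs i)) (λ i → h≤t (fs i)))

  ≤v-∑L : ∀ {h} {X : Set} (f : X → Carrier) (xs : List X) → (∀ x → h ≤v f x) → h ≤v ∑L (map f xs)
  ≤v-∑L f []       h≤f = ≤v-0#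
  ≤v-∑L f (x ∷ xs) h≤f = ≤v-+ (h≤f x) (≤v-∑L f xs h≤f)

  0≤v-ℕ⇒F : ∀ n → fin 0ℤ ≤v ℕ⇒F n
  0≤v-ℕ⇒F zero    = ≤v-0#
  0≤v-ℕ⇒F (suc n) = ≤v-+ (≤∞-reflexive (sym v-1#)) (0≤v-ℕ⇒F n)

  v-*-mono : ∀ {x x′ y y′} → v x ≤∞ v x′ → v y ≤∞ v y′ → v (x * y) ≤∞ v (x′ * y′)
  v-*-mono {x} {x′} {y} {y′} x≤x′ y≤y′ =
    subst₂ _≤∞_ (sym (v-mul x y)) (sym (v-mul x′ y′)) (+∞-mono-≤ x≤x′ y≤y′)

  v-^-mono : ∀ {x y} n → v x ≤∞ v y → v (x ^ n) ≤∞ v (y ^ n)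
  v-^-mono zero    x≤y = ≤∞-refl
  v-^-mono (suc n) x≤y = v-*-mono x≤y (v-^-mono n x≤y)

  -- x ≡ y mod z  and  x ≡ y mod⟨ z , w ⟩  are this relation at  v z  and  min∞ (v z) (v w).
  infix 4 _≡_modᵥ_
  _≡_modᵥ_ : Carrier → Carrier → ℤ∞ → Set
  x ≡ y modᵥ h = h ≤v x - y

  ≡-modᵥ-reflexive : ∀ {h x y} → x ≈ y → x ≡ y modᵥ h
  ≡-modᵥ-reflexive x≈y = ≤v-cong (≈-sym (x≈y⇒x∙y⁻¹≈ε x≈y)) ≤v-0#

  ≡-modᵥ-refl : ∀ {h x} → x ≡ x modᵥ h
  ≡-modᵥ-refl = ≡-modᵥ-reflexive ≈-refl

  ≡-modᵥ-sym : ∀ {h x y} → x ≡ y modᵥ h → y ≡ x modᵥ h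
  ≡-modᵥ-sym {x = x} {y} x≡y = ≤v-cong (⁻¹-anti-homo‿- x y) (≤v-neg x≡y)

  ≡-modᵥ-trans : ∀ {h x y z} → x ≡ y modᵥ h → y ≡ z modᵥ h → x ≡ z modᵥ h
  ≡-modᵥ-trans {x = x} {y} {z} x≡y y≡z = ≤v-cong [x-y]+[y-z]≈x-z (≤v-+ x≡y y≡z)
    where
    open import Relation.Binary.Reasoning.Setoid setoid
    [x-y]+[y-z]≈x-z : (x - y) + (y - z) ≈ x - z
    [x-y]+[y-z]≈x-z = begin
      (x - y) + (y - z)      ≈⟨ +-assoc x (- y) (y - z) ⟩
      x + (- y + (y - z))    ≈⟨ +-congˡ (+-assoc (- y) y (- z)) ⟨
      x + ((- y + y) - z)    ≈⟨ +-congˡ (+-cong (-‿inverseˡ y) ≈-refl) ⟩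
      x + (0# - z)           ≈⟨ +-congˡ (+-identityˡ (- z)) ⟩
      x - z                  ∎

  ≡-modᵥ-setoid : ℤ∞ → Setoid c 0ℓ
  ≡-modᵥ-setoid h = record
    { Carrier       = Carrier
    ; _≈_           = _≡_modᵥ h
    ; isEquivalence = record
      { refl  = ≡-modᵥ-refl
      ; sym   = ≡-modᵥ-sym
      ; trans = ≡-modᵥ-trans
      }
    }

  ≡-modᵥ-+ : ∀ {h x x′ y y′} → x ≡ x′ modᵥ h → y ≡ y′ modᵥ h → x + y ≡ x′ + y′ modᵥ h
  ≡-modᵥ-+ {x = x} {x′} {y} {y′} x≡x′ y≡y′ = ≤v-cong [x-x′]+[y-y′]≈x+y-[x′+y′] (≤v-+ x≡x′ y≡y′)
    where
    [x-x′]+[y-y′]≈x+y-[x′+y′] : (x - x′) + (y - y′) ≈ (x + y) - (x′ + y′)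
    [x-x′]+[y-y′]≈x+y-[x′+y′] =
      ≈-trans (interchange x (- x′) y (- y′)) (+-congˡ (⁻¹-∙-comm x′ y′))

  ≡-modᵥ-weaken : ∀ {g h x y} → g ≤∞ h → x ≡ y modᵥ h → x ≡ y modᵥ g
  ≡-modᵥ-weaken = ≤∞-trans

  ≤v⇒≡0#-modᵥ : ∀ {h x} → h ≤v x → x ≡ 0# modᵥ h
  ≤v⇒≡0#-modᵥ {x = x} = ≤v-cong (≈-sym (≈-trans (+-congˡ ε⁻¹≈ε) (+-identityʳ x)))

  ≡-modᵥ-∑L : ∀ {h} {X : Set} {f g : X → Carrier} (xs : List X) → (∀ x → f x ≡ g x modᵥ h) →
              ∑L (map f xs) ≡ ∑L (map g xs) modᵥ h
  ≡-modᵥ-∑L []       f≡g = ≡-modᵥ-refl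
  ≡-modᵥ-∑L (x ∷ xs) f≡g = ≡-modᵥ-+ (f≡g x) (≡-modᵥ-∑L xs f≡g)

  ^≡^ : ∀ x n → x ^ n ≡ x Exp.^ n
  ^≡^ x zero    = refl
  ^≡^ x (suc n) = cong (x *_) (^≡^ x n)

  ^-congˡ : ∀ {x y} n → x ≈ y → x ^ n ≈ y ^ n
  ^-congˡ {x} {y} n x≈y rewrite ^≡^ x n | ^≡^ y n = Exp.^-congˡ n x≈y

  ^-homo-* : ∀ x m n → x ^ (m ℕ.+ n) ≈ x ^ m * x ^ n
  ^-homo-* x m n rewrite ^≡^ x (m ℕ.+ n) | ^≡^ x m | ^≡^ x n = Exp.^-homo-* x m n

  ^-distrib-* : ∀ x y n → (x * y) ^ n ≈ x ^ n * y ^ n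
  ^-distrib-* x y n rewrite ^≡^ (x * y) n | ^≡^ x n | ^≡^ y n = CExp.^-distrib-* x y n

  1^n≈1 : ∀ n → 1# ^ n ≈ 1#
  1^n≈1 zero    = ≈-refl
  1^n≈1 (suc n) = ≈-trans (*-identityˡ _) (1^n≈1 n)

  ·≈ℕ⇒F* : ∀ n x → n · x ≈ ℕ⇒F n * x
  ·≈ℕ⇒F* zero    x = ≈-sym (zeroˡ x)
  ·≈ℕ⇒F* (suc n) x = ≈-trans (+-cong (≈-sym (*-identityˡ x)) (·≈ℕ⇒F* n x)) (≈-sym (distribʳ x 1# (ℕ⇒F n)))

  module _ {a b : Carrier} where

    binomialTerm≡ : ∀ n k → binomialTerm a b n k ≡ (n C toℕ k) · (a ^ toℕ k * b ^ (n ∸ toℕ k))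
    binomialTerm≡ n k = cong₂ (λ x y → (n C toℕ k) · (x * y)) (sym (^≡^ a (toℕ k))) (sym (^≡^ b (n ∸ toℕ k)))

    binomialTerm-first : ∀ n → binomialTerm a b n fz ≈ b ^ n
    binomialTerm-first n = ≈-trans (+-identityʳ _) (≈-trans (*-identityˡ _) (≈-reflexive (sym (^≡^ b n))))

    binomialTerm-last : ∀ n → binomialTerm a b n (fromℕ n) ≈ a ^ n
    binomialTerm-last n = begin
      binomialTerm a b n (fromℕ n)
        ≡⟨ cong (λ k → (n C k) · (a Exp.^ k * b Exp.^ (n ∸ k))) (toℕ-fromℕ n) ⟩
      (n C n) · (a Exp.^ n * b Exp.^ (n ∸ n))
        ≡⟨ cong₂ (λ m l → m · (a Exp.^ n * b Exp.^ l)) (nCn≡1 n) (ℕ.n∸n≡0 n) ⟩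
      a Exp.^ n * 1# + 0#
        ≈⟨ ≈-trans (+-identityʳ _) (*-identityʳ _) ⟩
      a Exp.^ n
        ≡⟨ ^≡^ a n ⟨
      a ^ n
        ∎
      where open import Relation.Binary.Reasoning.Setoid setoid

    ≤v-binomialTerm : ∀ {n c} → Prime n → v c ≤∞ v a → v c ≤∞ v b →
                      ∀ k → 0 ℕ.< toℕ k → toℕ k ℕ.< n → v (ℕ⇒F n * c ^ n) ≤v binomialTerm a b n k
    ≤v-binomialTerm {n} {c} n-prime c≤a c≤b k 0<k k<n =
      ≤v-cong (≈-sym (≈-trans (≈-reflexive (binomialTerm≡ n k)) nCk·z≈n*[q·z]))
              (v-*-mono ≤∞-refl (≤v-· q c^n≤z))
      where
      n∣nCk = p∣pCk n-prime 0<k k<n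
      q = quotient n∣nCk
      z = a ^ toℕ k * b ^ (n ∸ toℕ k)

      nCk·z≈n*[q·z] : (n C toℕ k) · z ≈ ℕ⇒F n * (q · z)
      nCk·z≈n*[q·z] = begin
        (n C toℕ k) · z   ≡⟨ cong (_· z) (m∣n⇒n≡m*quotient n∣nCk) ⟩
        (n ℕ.* q) · z     ≈⟨ ×-assocˡ z n q ⟨
        n · (q · z)       ≈⟨ ·≈ℕ⇒F* n (q · z) ⟩
        ℕ⇒F n * (q · z)   ∎
        where open import Relation.Binary.Reasoning.Setoid setoid

      c^n≤z : v (c ^ n) ≤∞ v z
      c^n≤z = subst (λ m → v (c ^ m) ≤∞ v z) (ℕ.m+[n∸m]≡n (ℕ.<⇒≤ k<n))
                (subst (_≤∞ v z) (v-cong (≈-sym (^-homo-* c (toℕ k) (n ∸ toℕ k))))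
                  (v-*-mono (v-^-mono (toℕ k) c≤a) (v-^-mono (n ∸ toℕ k) c≤b)))

    freshmansDream : ∀ {n c} → Prime n → v c ≤∞ v a → v c ≤∞ v b →
               (a + b) ^ n ≡ a ^ n + b ^ n modᵥ v (ℕ⇒F n * c ^ n)
    freshmansDream {suc q} {c} n-prime c≤a c≤b = begin
      (a + b) ^ n
        ≈⟨ ≡-modᵥ-reflexive (≈-trans (≈-reflexive (^≡^ (a + b) n)) (theorem n a b)) ⟩
      T fz + sum (λ j → T (fs j))
        ≈⟨ ≡-modᵥ-reflexive (+-congˡ (sum-init-last (λ j → T (fs j)))) ⟩
      T fz + (sum (λ j → T (fs (inject₁ j))) + T (fromℕ n))
        ≈⟨ ≡-modᵥ-+ ≡-modᵥ-refl (≡-modᵥ-+ (≤v⇒≡0#-modᵥ (≤v-sum _ middle)) ≡-modᵥ-refl) ⟩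
      T fz + (0# + T (fromℕ n))
        ≈⟨ ≡-modᵥ-reflexive (≈-trans (+-cong (binomialTerm-first n) (≈-trans (+-identityˡ _) (binomialTerm-last n)))
                                      (+-comm (b ^ n) (a ^ n))) ⟩
      a ^ n + b ^ n
        ∎
      where
      open import Relation.Binary.Reasoning.Setoid (≡-modᵥ-setoid (v (ℕ⇒F (suc q) * c ^ suc q)))
      n = suc q
      T = binomialTerm a b n
      middle : ∀ j → v (ℕ⇒F n * c ^ n) ≤v T (fs (inject₁ j))
      middle j = ≤v-binomialTerm n-prime c≤a c≤b (fs (inject₁ j)) (s≤s z≤n)
                   (s≤s (subst (ℕ._< q) (sym (toℕ-inject₁ j)) (toℕ<n j)))

  0≡x+y⇒-x≡y : ∀ {h x y} → 0# ≡ x + y modᵥ h → - x ≡ y modᵥ h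
  0≡x+y⇒-x≡y {x = x} {y} = ≤v-cong (≈-trans (+-identityˡ _) (≈-sym (⁻¹-∙-comm x y)))

  ≤v-resp-≡-modᵥ : ∀ {h g x y} → h ≤∞ g → x ≡ y modᵥ g → h ≤v x → h ≤v y
  ≤v-resp-≡-modᵥ {x = x} {y} h≤g x≡y h≤x = ≤v-cong x-[x-y]≈y (≤v-+ h≤x (≤v-neg (≤∞-trans h≤g x≡y)))
    where
    open import Relation.Binary.Reasoning.Setoid setoid
    x-[x-y]≈y : x - (x - y) ≈ y
    x-[x-y]≈y = begin
      x - (x - y)    ≈⟨ +-congˡ (⁻¹-anti-homo‿- x y) ⟩
      x + (y - x)    ≈⟨ +-assoc x y (- x) ⟨
      (x + y) - x    ≈⟨ xyx⁻¹≈y x y ⟩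
      y              ∎

  -- Exact for odd n; for n = 2 the error 2t² is a multiple of the modulus.
  neg-^ : ∀ {n c t} → Prime n → v c ≤∞ v t → - (t ^ n) ≡ (- t) ^ n modᵥ v (ℕ⇒F n * c ^ n)
  neg-^ {suc q} {t = t} n-prime c≤t = 0≡x+y⇒-x≡y (≡-modᵥ-trans 0≡[t-t]^n (freshmansDream n-prime c≤t (≤v-neg c≤t)))
    where
    0≡[t-t]^n : 0# ≡ (t - t) ^ suc q modᵥ _
    0≡[t-t]^n = ≡-modᵥ-reflexive (≈-sym (≈-trans (^-congˡ (suc q) (-‿inverseʳ t)) (zeroˡ _)))

  freshmansDream-∑L : ∀ {n c} {X : Set} (f : X → Carrier) (xs : List X) → Prime n → (∀ x → v c ≤∞ v (f x)) →
                ∑L (map (λ x → f x ^ n) xs) ≡ ∑L (map f xs) ^ n modᵥ v (ℕ⇒F n * c ^ n)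
  freshmansDream-∑L {suc q} f []       n-prime c≤f = ≡-modᵥ-reflexive (≈-sym (zeroˡ _))
  freshmansDream-∑L         f (x ∷ xs) n-prime c≤f = ≡-modᵥ-trans
    (≡-modᵥ-+ ≡-modᵥ-refl (freshmansDream-∑L f xs n-prime c≤f))
    (≡-modᵥ-sym (freshmansDream n-prime (c≤f x) (≤v-∑L f xs c≤f)))

  ^-≡-modᵥ-bounded : ∀ {n c x y μ} → Prime n → v c ≤∞ v x → v c ≤∞ v y → x ≡ y modᵥ v μ →
                   x ^ n ≡ y ^ n modᵥ min∞ (v (ℕ⇒F n * c ^ n)) (v (μ ^ n))
  ^-≡-modᵥ-bounded {n} {c} {x} {y} {μ} n-prime c≤x c≤y x≡y = begin
    x ^ n                ≈⟨ ≡-modᵥ-reflexive (^-congˡ n (≈-sym (y+[x-y]≈x))) ⟩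
    (y + (x - y)) ^ n    ≈⟨ ≡-modᵥ-weaken (min∞-≤ˡ _ _) (freshmansDream n-prime c≤y (≤v-+ c≤x (≤v-neg c≤y))) ⟩
    y ^ n + (x - y) ^ n  ≈⟨ ≡-modᵥ-+ ≡-modᵥ-refl (≡-modᵥ-weaken (min∞-≤ʳ _ _) (≤v⇒≡0#-modᵥ (v-^-mono n x≡y))) ⟩
    y ^ n + 0#           ≈⟨ ≡-modᵥ-reflexive (+-identityʳ _) ⟩
    y ^ n                ∎
    where
    open import Relation.Binary.Reasoning.Setoid (≡-modᵥ-setoid (min∞ (v (ℕ⇒F n * c ^ n)) (v (μ ^ n))))
    y+[x-y]≈x : y + (x - y) ≈ x
    y+[x-y]≈x = ≈-trans (≈-sym (+-assoc y x (- y))) (xyx⁻¹≈y y x)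

  ^-≡-modᵥ : ∀ {n c x y μ} → Prime n → v c ≤∞ v x → x ≡ y modᵥ v μ →
             x ^ n ≡ y ^ n modᵥ min∞ (v (ℕ⇒F n * c ^ n)) (v (μ ^ n))
  -- Of c and μ, the one of smaller valuation bounds both x and y.
  ^-≡-modᵥ {n} {c} {x} {y} {μ} n-prime c≤x x≡y with ≤∞-total (v c) (v μ)
  ... | inj₁ c≤μ = ^-≡-modᵥ-bounded n-prime c≤x (≤v-resp-≡-modᵥ c≤μ x≡y c≤x) x≡y
  ... | inj₂ μ≤c = ≡-modᵥ-weaken bound (^-≡-modᵥ-bounded n-prime μ≤x (≤v-resp-≡-modᵥ ≤∞-refl x≡y μ≤x) x≡y)
    where
    μ≤x = ≤∞-trans μ≤c c≤x
    μ^n≤nμ^n : v (μ ^ n) ≤∞ v (ℕ⇒F n * μ ^ n)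
    μ^n≤nμ^n = subst (v (μ ^ n) ≤∞_) (sym (v-mul _ _)) (x≤y+∞x _ (0≤v-ℕ⇒F n))
    bound : min∞ (v (ℕ⇒F n * c ^ n)) (v (μ ^ n)) ≤∞ min∞ (v (ℕ⇒F n * μ ^ n)) (v (μ ^ n))
    bound = min∞-glb (≤∞-trans (min∞-≤ʳ _ _) μ^n≤nμ^n) (min∞-≤ʳ _ _)

  ∏-^ : ∀ {k} n (f : Fin k → Carrier) → ∏ (λ i → f i ^ n) ≈ ∏ f ^ n
  ∏-^ {zero}  n f = ≈-sym (1^n≈1 n)
  ∏-^ {suc k} n f = ≈-trans (*-congˡ (∏-^ n (λ i → f (fs i)))) (≈-sym (^-distrib-* (f fz) _ n))

  module _ {k} (A : Matrix k) where

    ≤v-signedTerm : ∀ {h} σ → h ≤v term A σ → h ≤v signedTerm A σ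
    ≤v-signedTerm σ h≤t with even (inversions σ)
    ... | true  = h≤t
    ... | false = ≤v-neg h≤t

    ≤v-det : ∀ {h} → (∀ σ → h ≤v term A σ) → h ≤v det A
    ≤v-det h≤terms = ≤v-∑L (signedTerm A) (perms k) (λ σ → ≤v-signedTerm σ (h≤terms σ))

    signedTerm-φM : ∀ {c} σ → v c ≤∞ v (term A σ) →
                    signedTerm (φM A) σ ≡ φ (signedTerm A σ) modᵥ v (ℕ⇒F p * c ^ p)
    signedTerm-φM σ c≤t with even (inversions σ)
    ... | true  = ≡-modᵥ-reflexive (∏-^ p (λ i → A i (σ ⟨$⟩ʳ i)))
    ... | false = ≡-modᵥ-trans (≡-modᵥ-reflexive (-‿cong (∏-^ p (λ i → A i (σ ⟨$⟩ʳ i))))) (neg-^ p-prime c≤t)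

    det-φM : ∀ {c} → (∀ σ → v c ≤∞ v (term A σ)) → det (φM A) ≡ φ (det A) modᵥ v (ℕ⇒F p * c ^ p)
    det-φM c≤terms = ≡-modᵥ-trans
      (≡-modᵥ-∑L (perms k) (λ σ → signedTerm-φM σ (c≤terms σ)))
      (freshmansDream-∑L (signedTerm A) (perms k) p-prime (λ σ → ≤v-signedTerm σ (c≤terms σ)))

lemma6p1 : ∀ {c ℓ : Level} (F : LocalField c ℓ) → let open LF F in
           (k : ℕ) (A : Matrix k) (τ : Permutation′ k) →
           (∀ (σ : Permutation′ k) → v (term A τ) ≤∞ v (term A σ)) →
           (det (φM A) ≡ φ (det A) mod (ℕ⇒F p * (term A τ) ^ p))
           × (∀ (d μ : Carrier) → det A ≡ d mod μ →
              det (φM A) ≡ φ d mod⟨ ℕ⇒F p * (term A τ) ^ p , μ ^ p ⟩)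
lemma6p1 F k A τ τ-minimal =
  det-φM F A τ-minimal ,
  λ d μ det≡d → ≡-modᵥ-trans F (≡-modᵥ-weaken F (min∞-≤ˡ _ _) (det-φM F A τ-minimal))
                                (^-≡-modᵥ F p-prime (≤v-det F A τ-minimal) det≡d)
  where open LocalField F using (p-prime)
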